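{- Let $\gamma,n\in\mathbb{N}_0$ and $\beta,\lambda\in\mathbb{N}$. For $k\in\{0,1,\dots,n\}$ consider barred preferential arrangements of $X_n=\{1,\dots,n\}$ with $\lambda-1$ bars (so $\lambda$ sections) in which: the first section has $\gamma+k\beta$ labelled compartments, organised as $\gamma$ compartments together with $k$ distinct labelled parts each consisting of $\beta$ labelled compartments, its elements being distributed into these compartments (each element of the first section placed in exactly one compartment), with the requirement that none of the $k$ parts is empty; and each of the remaining $\lambda-1$ sections is a (possibly empty) preferential arrangement whose blocks each have $\beta$ labelled compartments (each element of such a section receives a label from $\{1,\dots,\beta\}$). The total number of such arrangements, summed over $k=0,1,\dots,n$, equals $$\sum_{k=0}^{n}\sum_{s=0}^{k}(-1)^{k-s}\binom{k}{s}H_n(\lambda-1,\beta,\gamma+\beta s),$$ where $H_n(\lambda,\beta,\gamma)$ denotes the coefficient of $\frac{x^n}{n!}$ in $\frac{e^{\gamma x}}{(2-e^{\beta x})^{\lambda}}$.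
   Context: A preferential arrangement of a finite set is an ordered set partition (sequence of non-empty disjoint blocks covering the set). A barred preferential arrangement with $\xi$ bars consists of $\xi$ identical bars creating $\xi+1$ ordered sections, with the elements distributed among the sections and each section carrying a (possibly empty) preferential arrangement. For $\lambda-1=0$ there are no bars and only the first section. Convention $0^0=1$. -}

module Defs where

open import Data.Nat as ℕ using (ℕ; zero; suc; _≤_; _<_)
open import Data.Nat.Combinatorics using (_C_)
open import Data.Integer as ℤ using (ℤ; +_; -_)
open import Data.Fin using (Fin)
open import Data.Vec using (Vec; lookup)
open import Data.List using (List; []; _∷_; map; upTo; zipWith; length; foldr)
open import Data.List.Relation.Unary.Unique.Propositional using (Unique)
open import Data.List.Membership.Propositional using (_∈_)
open import Data.Sum using (_⊎_; inj₁; inj₂)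
open import Data.Product using (Σ; _×_; _,_; ∃; ∃-syntax)
open import Function using (_⇔_)
open import Relation.Binary.PropositionalEquality using (_≡_)

sumℤ : List ℤ → ℤ
sumℤ = foldr ℤ._+_ (+ 0)

∑≤ : ℕ → (ℕ → ℤ) → ℤ
∑≤ n f = sumℤ (map f (upTo (suc n)))

syntax ∑≤ n (λ i → e) = ∑[ i ≤ n ] e

-- Exponential generating functions over ℤ:
-- a series is its sequence of coefficients of x^n / n!.

EGF : Set
EGF = ℕ → ℤ

_⊙_ : EGF → EGF → EGF
(a ⊙ b) n = ∑[ i ≤ n ] (+ (n C i) ℤ.* a i ℤ.* b (n ℕ.∸ i))

oneS : EGF
oneS zero    = + 1
oneS (suc _) = + 0

powS : EGF → ℕ → EGF
powS f zero    = oneS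
powS f (suc m) = f ⊙ powS f m

expS : ℕ → EGF
expS c n = + (c ℕ.^ n)

twoMinusExp : ℕ → EGF
twoMinusExp β zero    = + 1
twoMinusExp β (suc j) = - (+ (β ℕ.^ suc j))

-- Reciprocal g = 1/f of an EGF f with constant term 1, i.e. the unique g
-- with f ⊙ g = oneS: g 0 = 1, g (m+1) = - Σ_{j=1}^{m+1} C(m+1,j) f j g (m+1-j).
-- invPrefix f m = [g m , g (m-1) , … , g 0].
invPrefix : EGF → ℕ → List ℤ
invPrefix f zero    = + 1 ∷ []
invPrefix f (suc m) =
  - sumℤ (zipWith (λ i g → + (suc m C suc i) ℤ.* f (suc i) ℤ.* g)
                 (upTo (suc m)) (invPrefix f m))
  ∷ invPrefix f m

inv1 : EGF → EGF
inv1 f m with invPrefix f m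
... | g ∷ _ = g
... | []    = + 0

H : ℕ → ℕ → ℕ → ℕ → ℤ
H n λ′ β γ = (expS γ ⊙ powS (inv1 (twoMinusExp β)) λ′) n

HasCardinality : {A : Set} → (A → Set) → ℕ → Set
HasCardinality {A} P N =
  Σ (List A) λ L → Unique L × (∀ a → (a ∈ L) ⇔ P a) × length L ≡ N

-- Barred preferential arrangements (with l = λ-1 bars, so sections
-- 0 (first), and later sections indexed by Fin l).
--
-- Each element of X_n = Fin n receives a Place:
--  * first c : it lies in the first section, in compartment c, where
--      inj₁ g       = the g-th of the γ plain compartments,
--      inj₂ (p , c) = compartment c (of β) of the p-th part (p < k);
--  * later i b c : it lies in the later section i, in block number b of
--      the preferential arrangement of that section, with compartment
--      label c ∈ {1..β}.
-- A preferential arrangement of a section is encoded by the block number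
-- map; its image must be an initial segment {0,…,m-1} of ℕ (blocks are
-- then B_0,…,B_{m-1}, all non-empty).

data Place (γ β l : ℕ) : Set where
  first : Fin γ ⊎ (ℕ × Fin β) → Place γ β l
  later : Fin l → ℕ → Fin β → Place γ β l

Arrangement : (n γ β l : ℕ) → Set
Arrangement n γ β l = ℕ × Vec (Place γ β l) n   -- (k , placement)

ValidArrangement : (n γ β l : ℕ) → Arrangement n γ β l → Set
ValidArrangement n γ β l (k , v) =
  k ≤ n
  × (∀ x p c → lookup v x ≡ first (inj₂ (p , c)) → p < k)
  × (∀ p → p < k → ∃[ x ] ∃[ c ] lookup v x ≡ first (inj₂ (p , c)))
  × (∀ x i b c → lookup v x ≡ later i b c →
       ∀ b′ → b′ < b → ∃[ y ] ∃[ c′ ] lookup v y ≡ later i b′ c′)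

-- Write Cov a j for the exponential generating function e^{ax} (e^{βx} − 1)^j. Its coefficients
-- coverings a j n count the maps from n labelled elements to a plain compartments and j labelled
-- groups of β compartments that hit every group. Since 1/(2 − e^{βx}) = Σ_m (e^{βx} − 1)^m and
-- Σ_s (−1)^{k−s} C(k,s) e^{(γ+βs)x} = e^{γx} (e^{βx} − 1)^k, the k-th inner sum of the right-hand
-- side is Σ over (m_1, …, m_{λ−1}) of coverings γ (k + m_1 + ⋯ + m_{λ−1}) n. On the other side, an
-- arrangement with k parts and m_i blocks in the i-th later section is precisely such a covering map
-- onto k + Σ m_i groups (the parts, then the blocks of each later section). Such covering maps are
-- listed without repetition by placing one element at a time.

module Submission where

open import Defs
open import Data.Nat using (ℕ; _≤_; _∸_; _*_; _+_)
open import Data.Nat.Combinatorics using (_C_)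
open import Data.Integer using (+_; -[1+_]) renaming (_*_ to _*ℤ_; _^_ to _^ℤ_)
open import Data.Product using (Σ; _×_; _,_)
open import Relation.Binary.PropositionalEquality using (_≡_)

open import Data.Nat using (zero; suc; pred; _<_; _^_; _⊔_; z≤n; s≤s)
import Data.Nat.Properties as ℕ
import Data.Nat.Tactic.RingSolver as ℕ-Solver
open import Data.Nat.Combinatorics using (nCk+nC[k+1]≡[n+1]C[k+1]; k>n⇒nCk≡0)
open import Data.Integer using (ℤ; -_) renaming (_+_ to _+ℤ_)
import Data.Integer.Properties as ℤ
open import Data.Integer.Tactic.RingSolver using (solve-∀)
open import Algebra.Properties.CommutativeSemigroup ℤ.+-commutativeSemigroup using (interchange)
open import Data.Fin using (Fin)
import Data.Fin as Fin
open import Data.Fin.Properties using (any?)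
open import Data.Maybe using (Maybe; just; nothing)
open import Data.Maybe.Properties using (just-injective) renaming (≡-dec to ≡-decMaybe)
open import Data.List
  using (List; []; _∷_; _++_; [_]; map; concat; concatMap; upTo; allFin; zipWith; length; filter;
         cartesianProductWith; cartesianProduct)
import Data.List.Properties as List
open import Data.List.Membership.Propositional using (_∈_; find; lose)
open import Data.List.Membership.Propositional.Properties
  using (∈-map⁺; ∈-map⁻; ∈-++⁺ˡ; ∈-++⁺ʳ; ∈-++⁻; ∈-concatMap⁺; ∈-concatMap⁻; ∈-filter⁺; ∈-filter⁻;
         ∈-allFin; ∈-upTo⁺; ∈-upTo⁻; ∈-cartesianProductWith⁺; ∈-cartesianProduct⁺; ∈-cartesianProduct⁻; ∈-length)
open import Data.List.Relation.Unary.Any using (here; there)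
import Data.List.Relation.Unary.All as All
import Data.List.Relation.Unary.All.Properties as All
import Data.List.Relation.Unary.AllPairs as AllPairs
import Data.List.Relation.Unary.AllPairs.Properties as AllPairs
open import Data.List.Relation.Unary.Unique.Propositional using (Unique; []; _∷_)
open import Data.List.Relation.Unary.Unique.Propositional.Properties
  using (concat⁺; ++⁺; map⁺; filter⁺; upTo⁺; allFin⁺; cartesianProductWith⁺; cartesianProduct⁺)
open import Data.Vec using (Vec; []; _∷_; lookup; sum; tabulate)
import Data.Vec.Properties as Vec
open import Data.Sum using (inj₁; inj₂)
open import Data.Product using (∃-syntax; proj₁; proj₂)
open import Data.Empty using (⊥-elim)
open import Function using (_∘_; _⇔_; mk⇔; Equivalence)
open import Relation.Nullary using (Dec; yes; no; ¬_; ¬?; contradiction)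
open import Relation.Nullary.Decidable using (map′; _×-dec_)
open import Relation.Binary.Definitions using (DecidableEquality)
open import Relation.Binary.PropositionalEquality using (refl; sym; trans; cong; cong₂; subst; _≢_; module ≡-Reasoning)
open Equivalence using (to; from)
open ≡-Reasoning

-- Finite sums

sumOf : {A : Set} → List A → (A → ℤ) → ℤ
sumOf xs f = sumℤ (map f xs)

module _ {A : Set} where

  sumOf-cong : ∀ xs {f g : A → ℤ} → (∀ {x} → x ∈ xs → f x ≡ g x) → sumOf xs f ≡ sumOf xs g
  sumOf-cong []       f≗g = refl
  sumOf-cong (x ∷ xs) f≗g = cong₂ _+ℤ_ (f≗g (here refl)) (sumOf-cong xs (f≗g ∘ there))

  sumOf-zero : ∀ xs {f : A → ℤ} → (∀ {x} → x ∈ xs → f x ≡ + 0) → sumOf xs f ≡ + 0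
  sumOf-zero []       f≗0 = refl
  sumOf-zero (x ∷ xs) f≗0 = cong₂ _+ℤ_ (f≗0 (here refl)) (sumOf-zero xs (f≗0 ∘ there))

  sumOf-+ : ∀ xs (f g : A → ℤ) → sumOf xs (λ x → f x +ℤ g x) ≡ sumOf xs f +ℤ sumOf xs g
  sumOf-+ []       f g = refl
  sumOf-+ (x ∷ xs) f g = trans (cong (f x +ℤ g x +ℤ_) (sumOf-+ xs f g)) (interchange (f x) (g x) _ _)

  sumOf-*ˡ : ∀ xs c (f : A → ℤ) → sumOf xs (λ x → c *ℤ f x) ≡ c *ℤ sumOf xs f
  sumOf-*ˡ []       c f = sym (ℤ.*-zeroʳ c)
  sumOf-*ˡ (x ∷ xs) c f = trans (cong (c *ℤ f x +ℤ_) (sumOf-*ˡ xs c f)) (sym (ℤ.*-distribˡ-+ c (f x) _))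

  sumOf-neg : ∀ xs (f : A → ℤ) → sumOf xs (λ x → - f x) ≡ - sumOf xs f
  sumOf-neg xs f = begin
    sumOf xs (λ x → - f x)           ≡⟨ sumOf-cong xs (λ {x} _ → sym (ℤ.-1*i≡-i (f x))) ⟩
    sumOf xs (λ x → -[1+ 0 ] *ℤ f x) ≡⟨ sumOf-*ˡ xs -[1+ 0 ] f ⟩
    -[1+ 0 ] *ℤ sumOf xs f           ≡⟨ ℤ.-1*i≡-i _ ⟩
    - sumOf xs f                     ∎

  sumOf-++ : ∀ xs ys (f : A → ℤ) → sumOf (xs ++ ys) f ≡ sumOf xs f +ℤ sumOf ys f
  sumOf-++ []       ys f = sym (ℤ.+-identityˡ _)
  sumOf-++ (x ∷ xs) ys f = trans (cong (f x +ℤ_) (sumOf-++ xs ys f)) (sym (ℤ.+-assoc (f x) _ _))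

module _ {A B : Set} where

  sumOf-map : ∀ (g : A → B) xs (f : B → ℤ) → sumOf (map g xs) f ≡ sumOf xs (f ∘ g)
  sumOf-map g xs f = cong sumℤ (sym (List.map-∘ xs))

module _ {A B C : Set} where

  sumOf-cartesianProductWith : ∀ (g : A → B → C) xs ys (f : C → ℤ) →
    sumOf (cartesianProductWith g xs ys) f ≡ sumOf xs (λ x → sumOf ys (λ y → f (g x y)))
  sumOf-cartesianProductWith g []       ys f = refl
  sumOf-cartesianProductWith g (x ∷ xs) ys f = begin
    sumOf (map (g x) ys ++ cartesianProductWith g xs ys) f
      ≡⟨ sumOf-++ (map (g x) ys) _ f ⟩
    sumOf (map (g x) ys) f +ℤ sumOf (cartesianProductWith g xs ys) f
      ≡⟨ cong₂ _+ℤ_ (sumOf-map (g x) ys f) (sumOf-cartesianProductWith g xs ys f) ⟩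
    sumOf ys (λ y → f (g x y)) +ℤ sumOf xs (λ x′ → sumOf ys (λ y → f (g x′ y))) ∎

∑≤-cong : ∀ n {f g : ℕ → ℤ} → (∀ {i} → i ≤ n → f i ≡ g i) → ∑≤ n f ≡ ∑≤ n g
∑≤-cong n f≗g = sumOf-cong (upTo (suc n)) (f≗g ∘ ℕ.≤-pred ∘ ∈-upTo⁻)

∑≤-suc : ∀ n (f : ℕ → ℤ) → ∑≤ (suc n) f ≡ f 0 +ℤ ∑≤ n (f ∘ suc)
∑≤-suc n f = cong (λ xs → f 0 +ℤ sumℤ xs)
  (trans (List.map-applyUpTo suc f (suc n)) (sym (List.map-upTo (f ∘ suc) (suc n))))

∑≤-sucʳ : ∀ n (f : ℕ → ℤ) → ∑≤ (suc n) f ≡ ∑≤ n f +ℤ f (suc n)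
∑≤-sucʳ n f = begin
  sumOf (upTo (suc (suc n))) f             ≡⟨ cong (λ xs → sumOf xs f) (sym (List.upTo-∷ʳ (suc n))) ⟩
  sumOf (upTo (suc n) ++ [ suc n ]) f      ≡⟨ sumOf-++ (upTo (suc n)) _ f ⟩
  ∑≤ n f +ℤ (f (suc n) +ℤ + 0)             ≡⟨ cong (∑≤ n f +ℤ_) (ℤ.+-identityʳ _) ⟩
  ∑≤ n f +ℤ f (suc n)                      ∎

∑≤-extend : ∀ {m n} (f : ℕ → ℤ) → m ≤ n → (∀ {i} → m < i → f i ≡ + 0) → ∑≤ m f ≡ ∑≤ n f
∑≤-extend {n = zero}  f z≤n     f≗0 = refl
∑≤-extend {m} {suc n} f m≤1+n f≗0 with ℕ.m≤n⇒m<n∨m≡n m≤1+n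
... | inj₂ refl = refl
... | inj₁ m<1+n = begin
  ∑≤ m f                ≡⟨ ∑≤-extend f (ℕ.≤-pred m<1+n) f≗0 ⟩
  ∑≤ n f                ≡⟨ sym (ℤ.+-identityʳ _) ⟩
  ∑≤ n f +ℤ + 0         ≡⟨ cong (∑≤ n f +ℤ_) (sym (f≗0 m<1+n)) ⟩
  ∑≤ n f +ℤ f (suc n)   ≡⟨ sym (∑≤-sucʳ n f) ⟩
  ∑≤ (suc n) f          ∎

∑≤-pascal : ∀ k (h : ℕ → ℤ) →
  ∑≤ (suc k) (λ s → + (suc k C s) *ℤ h s)
    ≡ ∑≤ k (λ s → + (k C s) *ℤ h s) +ℤ ∑≤ k (λ s → + (k C s) *ℤ h (suc s))
∑≤-pascal k h = begin
  ∑≤ (suc k) (λ s → + (suc k C s) *ℤ h s)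
    ≡⟨ ∑≤-suc k (λ s → + (suc k C s) *ℤ h s) ⟩
  h₀ +ℤ ∑≤ k (λ s → + (suc k C suc s) *ℤ h (suc s))
    ≡⟨ cong (h₀ +ℤ_) (trans (∑≤-cong k (λ {s} _ → split s))
                          (sumOf-+ (upTo (suc k)) (λ s → + (k C s) *ℤ h (suc s)) (λ s → + (k C suc s) *ℤ h (suc s)))) ⟩
  h₀ +ℤ (∑≤ k (λ s → + (k C s) *ℤ h (suc s)) +ℤ ∑≤ k (λ s → + (k C suc s) *ℤ h (suc s)))
    ≡⟨ rearrange h₀ _ _ ⟩
  (h₀ +ℤ ∑≤ k (λ s → + (k C suc s) *ℤ h (suc s))) +ℤ ∑≤ k (λ s → + (k C s) *ℤ h (suc s))
    ≡⟨ cong (_+ℤ ∑≤ k (λ s → + (k C s) *ℤ h (suc s))) (sym unshifted) ⟩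
  ∑≤ k (λ s → + (k C s) *ℤ h s) +ℤ ∑≤ k (λ s → + (k C s) *ℤ h (suc s)) ∎
  where
  h₀ = + 1 *ℤ h 0
  rearrange : ∀ a x y → a +ℤ (x +ℤ y) ≡ (a +ℤ y) +ℤ x
  rearrange = solve-∀
  split : ∀ s → + (suc k C suc s) *ℤ h (suc s) ≡ + (k C s) *ℤ h (suc s) +ℤ + (k C suc s) *ℤ h (suc s)
  split s = begin
    + (suc k C suc s) *ℤ h (suc s)                ≡⟨ cong (λ c → + c *ℤ h (suc s)) (sym (nCk+nC[k+1]≡[n+1]C[k+1] k s)) ⟩
    + (k C s + k C suc s) *ℤ h (suc s)            ≡⟨ cong (_*ℤ h (suc s)) (ℤ.pos-+ (k C s) _) ⟩
    (+ (k C s) +ℤ + (k C suc s)) *ℤ h (suc s)     ≡⟨ ℤ.*-distribʳ-+ (h (suc s)) (+ (k C s)) (+ (k C suc s)) ⟩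
    + (k C s) *ℤ h (suc s) +ℤ + (k C suc s) *ℤ h (suc s) ∎
  unshifted : ∑≤ k (λ s → + (k C s) *ℤ h s) ≡ h₀ +ℤ ∑≤ k (λ s → + (k C suc s) *ℤ h (suc s))
  unshifted = trans (∑≤-extend _ (ℕ.n≤1+n k) beyond) (∑≤-suc k (λ s → + (k C s) *ℤ h s))
    where
    beyond : ∀ {s} → k < s → + (k C s) *ℤ h s ≡ + 0
    beyond k<s = cong (λ c → + c *ℤ h _) (k>n⇒nCk≡0 k<s)

module _ {A B : Set} where

  unique-concatMap : ∀ (f : A → List B) {xs} → Unique xs → (∀ {x} → x ∈ xs → Unique (f x)) →
                     (∀ {x y b} → b ∈ f x → b ∈ f y → x ≡ y) → Unique (concatMap f xs)
  unique-concatMap f !xs !f separated = concat⁺ (All.map⁺ (All.tabulate !f))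
    (AllPairs.map⁺ (AllPairs.map (λ x≢y {_} (b∈fx , b∈fy) → x≢y (separated b∈fx b∈fy)) !xs))

  length-concatMap-const : ∀ (f : A → List B) xs {c} → (∀ {x} → x ∈ xs → length (f x) ≡ c) →
                           length (concatMap f xs) ≡ length xs * c
  length-concatMap-const f []       len = refl
  length-concatMap-const f (x ∷ xs) len =
    trans (List.length-++ (f x)) (cong₂ _+_ (len (here refl)) (length-concatMap-const f xs (len ∘ there)))

  lengthℤ-concatMap : ∀ (f : A → List B) xs → + length (concatMap f xs) ≡ sumOf xs (λ x → + length (f x))
  lengthℤ-concatMap f []       = refl
  lengthℤ-concatMap f (x ∷ xs) = begin
    + length (f x ++ concatMap f xs)              ≡⟨ cong +_ (List.length-++ (f x)) ⟩
    + (length (f x) + length (concatMap f xs))    ≡⟨ ℤ.pos-+ (length (f x)) _ ⟩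
    + length (f x) +ℤ + length (concatMap f xs)   ≡⟨ cong (+ length (f x) +ℤ_) (lengthℤ-concatMap f xs) ⟩
    + length (f x) +ℤ sumOf xs (λ x → + length (f x)) ∎

module _ {A : Set} {n : ℕ} where

  ∈-concatMap-∷⁺ : ∀ (E : A → List (Vec A n)) {hs h w} → h ∈ hs → w ∈ E h →
                   (h ∷ w) ∈ concatMap (λ x → map (x ∷_) (E x)) hs
  ∈-concatMap-∷⁺ E h∈hs w∈Eh = ∈-concatMap⁺ (λ x → map (x ∷_) (E x)) (lose h∈hs (∈-map⁺ (_ ∷_) w∈Eh))

  ∈-concatMap-∷⁻ : ∀ (E : A → List (Vec A n)) hs {h w} → (h ∷ w) ∈ concatMap (λ x → map (x ∷_) (E x)) hs →
                   h ∈ hs × w ∈ E h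
  ∈-concatMap-∷⁻ E hs hw∈ with find (∈-concatMap⁻ (λ x → map (x ∷_) (E x)) hw∈)
  ... | h , h∈hs , hw∈Eh with ∈-map⁻ (h ∷_) hw∈Eh
  ...   | w , w∈Eh , refl = h∈hs , w∈Eh

length-map-allFin : ∀ {A : Set} {m} (f : Fin m → A) → length (map f (allFin m)) ≡ m
length-map-allFin {m = m} f = trans (List.length-map f (allFin m)) (List.length-tabulate {n = m} (λ i → i))

zipWith-map-self : ∀ {A B C : Set} (f : A → B → C) (g : A → B) xs →
                   zipWith f xs (map g xs) ≡ map (λ x → f x (g x)) xs
zipWith-map-self f g []       = refl
zipWith-map-self f g (x ∷ xs) = cong (f x (g x) ∷_) (zipWith-map-self f g xs)

length-concatMap-allFin : ∀ {A : Set} {m} (f : Fin m → List A) →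
                          length (concatMap f (allFin m)) ≡ sum (tabulate (length ∘ f))
length-concatMap-allFin {m = zero}  f = refl
length-concatMap-allFin {m = suc m} f = trans (List.length-++ (f Fin.zero)) (cong (_+_ (length (f Fin.zero)))
  (trans (cong (length ∘ concat) (trans (List.map-tabulate Fin.suc f) (sym (List.map-tabulate (λ i → i) (f ∘ Fin.suc)))))
         (length-concatMap-allFin (f ∘ Fin.suc))))

lookup≤sum : ∀ {m} (ms : Vec ℕ m) i → lookup ms i ≤ sum ms
lookup≤sum (m ∷ ms) Fin.zero    = ℕ.m≤m+n m (sum ms)
lookup≤sum (m ∷ ms) (Fin.suc i) = ℕ.≤-trans (lookup≤sum ms i) (ℕ.m≤n+m (sum ms) m)

≤-from-< : ∀ {m n} → (∀ {b} → b < m → b < n) → m ≤ n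
≤-from-< {zero}  below = z≤n
≤-from-< {suc m} below = below (ℕ.n<1+n m)

tuples : (l N : ℕ) → List (Vec ℕ l)
tuples zero    N = [ [] ]
tuples (suc l) N = cartesianProductWith _∷_ (upTo (suc N)) (tuples l N)

unique-tuples : ∀ l N → Unique (tuples l N)
unique-tuples zero    N = All.[] ∷ []
unique-tuples (suc l) N = cartesianProductWith⁺ _∷_ Vec.∷-injective (upTo⁺ (suc N)) (unique-tuples l N)

∈-tuples⁺ : ∀ {l N} (ms : Vec ℕ l) → (∀ i → lookup ms i ≤ N) → ms ∈ tuples l N
∈-tuples⁺ []       bounded = here refl
∈-tuples⁺ (m ∷ ms) bounded = ∈-cartesianProductWith⁺ _∷_ (∈-upTo⁺ (s≤s (bounded Fin.zero)))
                                                     (∈-tuples⁺ ms (bounded ∘ Fin.suc))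

-- Exponential generating functions

∂ : EGF → EGF
∂ a n = a (suc n)

⊙-cong : ∀ n {a a′ b b′ : EGF} → (∀ {i} → i ≤ n → a i ≡ a′ i) → (∀ {i} → i ≤ n → b i ≡ b′ i) →
         (a ⊙ b) n ≡ (a′ ⊙ b′) n
⊙-cong n a≗a′ b≗b′ = ∑≤-cong n λ {i} i≤n →
  cong₂ (λ x y → + (n C i) *ℤ x *ℤ y) (a≗a′ i≤n) (b≗b′ (ℕ.m∸n≤m n i))

⊙-leibniz : ∀ (a b : EGF) n → (a ⊙ b) (suc n) ≡ (a ⊙ ∂ b) n +ℤ (∂ a ⊙ b) n
⊙-leibniz a b n = begin
  (a ⊙ b) (suc n)
    ≡⟨ ∑≤-cong (suc n) (λ {i} _ → ℤ.*-assoc (+ (suc n C i)) (a i) (b (suc n ∸ i))) ⟩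
  ∑≤ (suc n) (λ i → + (suc n C i) *ℤ (a i *ℤ b (suc n ∸ i)))
    ≡⟨ ∑≤-pascal n (λ i → a i *ℤ b (suc n ∸ i)) ⟩
  ∑≤ n (λ i → + (n C i) *ℤ (a i *ℤ b (suc n ∸ i))) +ℤ ∑≤ n (λ i → + (n C i) *ℤ (a (suc i) *ℤ b (n ∸ i)))
    ≡⟨ cong₂ _+ℤ_ (∑≤-cong n (λ {i} i≤n → trans (cong (λ m → + (n C i) *ℤ (a i *ℤ b m)) (ℕ.+-∸-assoc 1 i≤n))
                                                (sym (ℤ.*-assoc (+ (n C i)) (a i) (∂ b (n ∸ i))))))
                  (∑≤-cong n (λ {i} _ → sym (ℤ.*-assoc (+ (n C i)) (∂ a i) (b (n ∸ i))))) ⟩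
  (a ⊙ ∂ b) n +ℤ (∂ a ⊙ b) n ∎

module _ (n : ℕ) where

  ⊙-+ˡ : ∀ (a a′ b : EGF) → ((λ i → a i +ℤ a′ i) ⊙ b) n ≡ (a ⊙ b) n +ℤ (a′ ⊙ b) n
  ⊙-+ˡ a a′ b = trans (∑≤-cong n (λ {i} _ → distrib (+ (n C i)) (a i) (a′ i) (b (n ∸ i))))
                      (sumOf-+ (upTo (suc n)) (λ i → + (n C i) *ℤ a i *ℤ b (n ∸ i))
                                              (λ i → + (n C i) *ℤ a′ i *ℤ b (n ∸ i)))
    where distrib : ∀ c x y z → c *ℤ (x +ℤ y) *ℤ z ≡ c *ℤ x *ℤ z +ℤ c *ℤ y *ℤ z
          distrib = solve-∀

  ⊙-+ʳ : ∀ (a b b′ : EGF) → (a ⊙ (λ i → b i +ℤ b′ i)) n ≡ (a ⊙ b) n +ℤ (a ⊙ b′) n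
  ⊙-+ʳ a b b′ = trans (∑≤-cong n (λ {i} _ → ℤ.*-distribˡ-+ (+ (n C i) *ℤ a i) (b (n ∸ i)) (b′ (n ∸ i))))
                      (sumOf-+ (upTo (suc n)) (λ i → + (n C i) *ℤ a i *ℤ b (n ∸ i))
                                              (λ i → + (n C i) *ℤ a i *ℤ b′ (n ∸ i)))

  ⊙-*ˡ : ∀ c (a b : EGF) → ((λ i → c *ℤ a i) ⊙ b) n ≡ c *ℤ (a ⊙ b) n
  ⊙-*ˡ c a b = trans (∑≤-cong n (λ {i} _ → pull (+ (n C i)) c (a i) (b (n ∸ i))))
                     (sumOf-*ˡ (upTo (suc n)) c (λ i → + (n C i) *ℤ a i *ℤ b (n ∸ i)))
    where pull : ∀ k c x z → k *ℤ (c *ℤ x) *ℤ z ≡ c *ℤ (k *ℤ x *ℤ z)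
          pull = solve-∀

  ⊙-*ʳ : ∀ c (a b : EGF) → (a ⊙ (λ i → c *ℤ b i)) n ≡ c *ℤ (a ⊙ b) n
  ⊙-*ʳ c a b = trans (∑≤-cong n (λ {i} _ → pull (+ (n C i)) c (a i) (b (n ∸ i))))
                     (sumOf-*ˡ (upTo (suc n)) c (λ i → + (n C i) *ℤ a i *ℤ b (n ∸ i)))
    where pull : ∀ k c x z → k *ℤ x *ℤ (c *ℤ z) ≡ c *ℤ (k *ℤ x *ℤ z)
          pull = solve-∀

  ⊙-sumˡ : ∀ {X : Set} xs (a : X → EGF) (b : EGF) →
           ((λ i → sumOf xs (λ x → a x i)) ⊙ b) n ≡ sumOf xs (λ x → (a x ⊙ b) n)
  ⊙-sumˡ []       a b = sumOf-zero (upTo (suc n)) (λ {i} _ → cong (_*ℤ b (n ∸ i)) (ℤ.*-zeroʳ (+ (n C i))))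
  ⊙-sumˡ (x ∷ xs) a b = trans (⊙-+ˡ (a x) (λ i → sumOf xs (λ y → a y i)) b) (cong ((a x ⊙ b) n +ℤ_) (⊙-sumˡ xs a b))

  ⊙-sumʳ : ∀ {X : Set} xs (a : EGF) (b : X → EGF) →
           (a ⊙ (λ i → sumOf xs (λ x → b x i))) n ≡ sumOf xs (λ x → (a ⊙ b x) n)
  ⊙-sumʳ []       a b = sumOf-zero (upTo (suc n)) (λ {i} _ → ℤ.*-zeroʳ (+ (n C i) *ℤ a i))
  ⊙-sumʳ (x ∷ xs) a b = trans (⊙-+ʳ a (b x) (λ i → sumOf xs (λ y → b y i))) (cong ((a ⊙ b x) n +ℤ_) (⊙-sumʳ xs a b))

powS-cong : ∀ l {f g : EGF} → (∀ i → f i ≡ g i) → ∀ n → powS f l n ≡ powS g l n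
powS-cong zero    f≗g n = refl
powS-cong (suc l) f≗g n = ⊙-cong n (λ {i} _ → f≗g i) (λ {i} _ → powS-cong l f≗g i)

module Coverings (β : ℕ) where

  -- The first element lies in a plain compartment or in a group that the others also hit
  -- (a + jβ choices), or it is alone in one of the j groups (jβ choices).
  coverings : ℕ → ℕ → ℕ → ℕ
  coverings a j (suc n) = (a + j * β) * coverings a j n + j * β * coverings a (pred j) n
  coverings a zero    zero = 1
  coverings a (suc j) zero = 0

  Cov : ℕ → ℕ → EGF
  Cov a j n = + coverings a j n

  coverings-vanish : ∀ a {j n} → n < j → coverings a j n ≡ 0
  coverings-vanish a {suc j} {zero}  _         = refl
  coverings-vanish a {suc j} {suc n} (s≤s n<j)
    rewrite coverings-vanish a {suc j} {n} (ℕ.m<n⇒m<1+n n<j) | coverings-vanish a {j} {n} n<j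
    = cong₂ _+_ (ℕ.*-zeroʳ (a + suc j * β)) (ℕ.*-zeroʳ (suc j * β))

  coverings-no-groups : ∀ a n → coverings a 0 n ≡ a ^ n
  coverings-no-groups a zero    = refl
  coverings-no-groups a (suc n) =
    trans (ℕ.+-identityʳ _) (cong₂ _*_ (ℕ.+-identityʳ a) (coverings-no-groups a n))

  coverings-one-group : ∀ n → coverings 0 1 (suc n) ≡ β ^ suc n
  coverings-one-group zero    = step β 1
    where step : ∀ b p → (0 + 1 * b) * 0 + 1 * b * p ≡ b * p
          step = ℕ-Solver.solve-∀
  coverings-one-group (suc n) = trans (cong (λ p → (0 + 1 * β) * p + 1 * β * 0) (coverings-one-group n))
                                      (step β (β ^ suc n))
    where step : ∀ b p → (0 + 1 * b) * p + 1 * b * 0 ≡ b * p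
          step = ℕ-Solver.solve-∀

  -- e^{βx} = (e^{βx} − 1) + 1
  coverings-shift : ∀ a k n → coverings (a + β) k n ≡ coverings a (suc k) n + coverings a k n
  coverings-shift a zero    zero    = refl
  coverings-shift a (suc k) zero    = refl
  coverings-shift a zero    (suc n) = trans (cong (λ p → (a + β + 0) * p + 0) (coverings-shift a 0 n))
                                            (step a β (coverings a 1 n) (coverings a 0 n))
    where step : ∀ a β p q → (a + β + 0) * (p + q) + 0 ≡ (a + 1 * β) * p + 1 * β * q + ((a + 0) * q + 0)
          step = ℕ-Solver.solve-∀
  coverings-shift a (suc k) (suc n) =
    trans (cong₂ (λ p q → (a + β + suc k * β) * p + suc k * β * q) (coverings-shift a (suc k) n) (coverings-shift a k n))
          (step a β k (coverings a (2 + k) n) (coverings a (suc k) n) (coverings a k n))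
    where step : ∀ a β k p q r → (a + β + suc k * β) * (p + q) + suc k * β * (q + r)
                   ≡ ((a + suc (suc k) * β) * p + suc (suc k) * β * q) + ((a + suc k * β) * q + suc k * β * r)
          step = ℕ-Solver.solve-∀

  Cov-suc : ∀ a j n → Cov a j (suc n) ≡ + (a + j * β) *ℤ Cov a j n +ℤ + (j * β) *ℤ Cov a (pred j) n
  Cov-suc a j n = trans (ℤ.pos-+ ((a + j * β) * coverings a j n) _)
                        (cong₂ _+ℤ_ (ℤ.pos-* (a + j * β) _) (ℤ.pos-* (j * β) _))

  ⊙-Cov : ∀ a j j′ n → (Cov a j ⊙ Cov 0 j′) n ≡ Cov a (j + j′) n
  ⊙-Cov a zero    zero     zero    = refl
  ⊙-Cov a zero    (suc j′) zero    = refl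
  ⊙-Cov a (suc j) j′       zero    = refl
  ⊙-Cov a j       j′       (suc n) = begin
    (Cov a j ⊙ Cov 0 j′) (suc n)
      ≡⟨ ⊙-leibniz (Cov a j) (Cov 0 j′) n ⟩
    (Cov a j ⊙ ∂ (Cov 0 j′)) n +ℤ (∂ (Cov a j) ⊙ Cov 0 j′) n
      ≡⟨ cong₂ _+ℤ_ right left ⟩
    (+ q *ℤ X +ℤ + q *ℤ Y) +ℤ (+ p *ℤ X +ℤ + r *ℤ Y)
      ≡⟨ regroup (+ p) (+ q) (+ r) X Y ⟩
    (+ p +ℤ + q) *ℤ X +ℤ (+ r +ℤ + q) *ℤ Y
      ≡⟨ cong₂ (λ u v → u *ℤ X +ℤ v *ℤ Y) (sym (ℤ.pos-+ p q)) (sym (ℤ.pos-+ r q)) ⟩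
    + (p + q) *ℤ X +ℤ + (r + q) *ℤ Y
      ≡⟨ cong₂ (λ u v → + u *ℤ X +ℤ + v *ℤ Y) (sum-of-rates a j j′ β) (sym (ℕ.*-distribʳ-+ β j j′)) ⟩
    + (a + (j + j′) * β) *ℤ X +ℤ + ((j + j′) * β) *ℤ Y
      ≡⟨ sym (Cov-suc a (j + j′) n) ⟩
    Cov a (j + j′) (suc n) ∎
    where
    p = a + j * β
    q = j′ * β
    r = j * β
    X = Cov a (j + j′) n
    Y = Cov a (pred (j + j′)) n
    regroup : ∀ p q r x y → (q *ℤ x +ℤ q *ℤ y) +ℤ (p *ℤ x +ℤ r *ℤ y) ≡ (p +ℤ q) *ℤ x +ℤ (r +ℤ q) *ℤ y
    regroup = solve-∀
    sum-of-rates : ∀ a j j′ β → a + j * β + j′ * β ≡ a + (j + j′) * β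
    sum-of-rates = ℕ-Solver.solve-∀
    -- the factor j * β kills the term in which pred j is not j − 1
    pred-+ˡ : ∀ j k → + (j * β) *ℤ Cov a (pred j + k) n ≡ + (j * β) *ℤ Cov a (pred (j + k)) n
    pred-+ˡ zero    k = refl
    pred-+ˡ (suc j) k = refl
    pred-+ʳ : ∀ j k → + (k * β) *ℤ Cov a (j + pred k) n ≡ + (k * β) *ℤ Cov a (pred (j + k)) n
    pred-+ʳ j zero    = refl
    pred-+ʳ j (suc k) = cong (λ m → + (suc k * β) *ℤ Cov a (pred m) n) (sym (ℕ.+-suc j k))
    left : (∂ (Cov a j) ⊙ Cov 0 j′) n ≡ + p *ℤ X +ℤ + r *ℤ Y
    left = begin
      (∂ (Cov a j) ⊙ Cov 0 j′) n
        ≡⟨ ⊙-cong n {a′ = λ i → + p *ℤ Cov a j i +ℤ + r *ℤ Cov a (pred j) i} {b′ = Cov 0 j′}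
                   (λ {i} _ → Cov-suc a j i) (λ _ → refl) ⟩
      ((λ i → + p *ℤ Cov a j i +ℤ + r *ℤ Cov a (pred j) i) ⊙ Cov 0 j′) n
        ≡⟨ ⊙-+ˡ n (λ i → + p *ℤ Cov a j i) (λ i → + r *ℤ Cov a (pred j) i) (Cov 0 j′) ⟩
      ((λ i → + p *ℤ Cov a j i) ⊙ Cov 0 j′) n +ℤ ((λ i → + r *ℤ Cov a (pred j) i) ⊙ Cov 0 j′) n
        ≡⟨ cong₂ _+ℤ_ (⊙-*ˡ n (+ p) (Cov a j) (Cov 0 j′)) (⊙-*ˡ n (+ r) (Cov a (pred j)) (Cov 0 j′)) ⟩
      + p *ℤ (Cov a j ⊙ Cov 0 j′) n +ℤ + r *ℤ (Cov a (pred j) ⊙ Cov 0 j′) n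
        ≡⟨ cong₂ (λ x y → + p *ℤ x +ℤ + r *ℤ y) (⊙-Cov a j j′ n) (⊙-Cov a (pred j) j′ n) ⟩
      + p *ℤ X +ℤ + r *ℤ Cov a (pred j + j′) n
        ≡⟨ cong (+ p *ℤ X +ℤ_) (pred-+ˡ j j′) ⟩
      + p *ℤ X +ℤ + r *ℤ Y ∎
    right : (Cov a j ⊙ ∂ (Cov 0 j′)) n ≡ + q *ℤ X +ℤ + q *ℤ Y
    right = begin
      (Cov a j ⊙ ∂ (Cov 0 j′)) n
        ≡⟨ ⊙-cong n {a′ = Cov a j} {b′ = λ i → + q *ℤ Cov 0 j′ i +ℤ + q *ℤ Cov 0 (pred j′) i}
                   (λ _ → refl) (λ {i} _ → Cov-suc 0 j′ i) ⟩
      (Cov a j ⊙ (λ i → + q *ℤ Cov 0 j′ i +ℤ + q *ℤ Cov 0 (pred j′) i)) n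
        ≡⟨ ⊙-+ʳ n (Cov a j) (λ i → + q *ℤ Cov 0 j′ i) (λ i → + q *ℤ Cov 0 (pred j′) i) ⟩
      (Cov a j ⊙ (λ i → + q *ℤ Cov 0 j′ i)) n +ℤ (Cov a j ⊙ (λ i → + q *ℤ Cov 0 (pred j′) i)) n
        ≡⟨ cong₂ _+ℤ_ (⊙-*ʳ n (+ q) (Cov a j) (Cov 0 j′)) (⊙-*ʳ n (+ q) (Cov a j) (Cov 0 (pred j′))) ⟩
      + q *ℤ (Cov a j ⊙ Cov 0 j′) n +ℤ + q *ℤ (Cov a j ⊙ Cov 0 (pred j′)) n
        ≡⟨ cong₂ (λ x y → + q *ℤ x +ℤ + q *ℤ y) (⊙-Cov a j j′ n) (⊙-Cov a j (pred j′) n) ⟩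
      + q *ℤ X +ℤ + q *ℤ Cov a (j + pred j′) n
        ≡⟨ cong (+ q *ℤ X +ℤ_) (pred-+ʳ j j′) ⟩
      + q *ℤ X +ℤ + q *ℤ Y ∎

  inclusion-exclusion : ∀ k a n →
    ∑[ s ≤ k ] ((-[1+ 0 ] ^ℤ (k ∸ s)) *ℤ + (k C s) *ℤ expS (a + β * s) n) ≡ Cov a k n
  inclusion-exclusion zero a n = begin
    + 1 *ℤ + 1 *ℤ expS (a + β * 0) n +ℤ + 0 ≡⟨ ℤ.+-identityʳ _ ⟩
    + 1 *ℤ + 1 *ℤ expS (a + β * 0) n        ≡⟨ ℤ.*-identityˡ _ ⟩
    + ((a + β * 0) ^ n)                     ≡⟨ cong (λ c → + (c ^ n)) (trans (cong (_+_ a) (ℕ.*-zeroʳ β))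
                                                                           (ℕ.+-identityʳ a)) ⟩
    + (a ^ n)                               ≡⟨ cong +_ (sym (coverings-no-groups a n)) ⟩
    Cov a 0 n                               ∎
  inclusion-exclusion (suc k) a n = begin
    ∑≤ (suc k) (λ s → (-[1+ 0 ] ^ℤ (suc k ∸ s)) *ℤ + (suc k C s) *ℤ E a s)
      ≡⟨ ∑≤-cong (suc k) (λ {s} _ → swap (-[1+ 0 ] ^ℤ (suc k ∸ s)) (+ (suc k C s)) (E a s)) ⟩
    ∑≤ (suc k) (λ s → + (suc k C s) *ℤ h s)
      ≡⟨ ∑≤-pascal k h ⟩
    ∑≤ k (λ s → + (k C s) *ℤ h s) +ℤ ∑≤ k (λ s → + (k C s) *ℤ h (suc s))
      ≡⟨ cong₂ _+ℤ_ (trans (∑≤-cong k (λ {s} s≤k → negated s s≤k)) (sumOf-neg (upTo (suc k)) (term a)))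
                    (∑≤-cong k (λ {s} _ → shifted s)) ⟩
    - ∑≤ k (term a) +ℤ ∑≤ k (term (a + β))
      ≡⟨ cong₂ (λ x y → - x +ℤ y) (inclusion-exclusion k a n) (inclusion-exclusion k (a + β) n) ⟩
    - Cov a k n +ℤ Cov (a + β) k n
      ≡⟨ cong (- Cov a k n +ℤ_) (trans (cong +_ (coverings-shift a k n)) (ℤ.pos-+ (coverings a (suc k) n) _)) ⟩
    - Cov a k n +ℤ (Cov a (suc k) n +ℤ Cov a k n)
      ≡⟨ cancel (Cov a k n) (Cov a (suc k) n) ⟩
    Cov a (suc k) n ∎
    where
    E : ℕ → ℕ → ℤ
    E c s = expS (c + β * s) n
    term : ℕ → ℕ → ℤ
    term c s = (-[1+ 0 ] ^ℤ (k ∸ s)) *ℤ + (k C s) *ℤ E c s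
    h : ℕ → ℤ
    h s = (-[1+ 0 ] ^ℤ (suc k ∸ s)) *ℤ E a s
    swap : ∀ x y z → x *ℤ y *ℤ z ≡ y *ℤ (x *ℤ z)
    swap = solve-∀
    cancel : ∀ x y → - x +ℤ (y +ℤ x) ≡ y
    cancel = solve-∀
    negated : ∀ s → s ≤ k → + (k C s) *ℤ h s ≡ - term a s
    negated s s≤k = begin
      + (k C s) *ℤ ((-[1+ 0 ] ^ℤ (suc k ∸ s)) *ℤ E a s)
        ≡⟨ cong (λ m → + (k C s) *ℤ ((-[1+ 0 ] ^ℤ m) *ℤ E a s)) (ℕ.+-∸-assoc 1 s≤k) ⟩
      + (k C s) *ℤ (-[1+ 0 ] *ℤ (-[1+ 0 ] ^ℤ (k ∸ s)) *ℤ E a s)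
        ≡⟨ flip (+ (k C s)) (-[1+ 0 ] ^ℤ (k ∸ s)) (E a s) ⟩
      - term a s ∎
      where flip : ∀ c x e → c *ℤ (-[1+ 0 ] *ℤ x *ℤ e) ≡ - (x *ℤ c *ℤ e)
            flip = solve-∀
    shifted : ∀ s → + (k C s) *ℤ h (suc s) ≡ term (a + β) s
    shifted s = begin
      + (k C s) *ℤ ((-[1+ 0 ] ^ℤ (k ∸ s)) *ℤ E a (suc s))
        ≡⟨ sym (swap (-[1+ 0 ] ^ℤ (k ∸ s)) (+ (k C s)) (E a (suc s))) ⟩
      (-[1+ 0 ] ^ℤ (k ∸ s)) *ℤ + (k C s) *ℤ E a (suc s)
        ≡⟨ cong (λ c → (-[1+ 0 ] ^ℤ (k ∸ s)) *ℤ + (k C s) *ℤ expS c n) (step a β s) ⟩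
      term (a + β) s ∎
      where step : ∀ a β s → a + β * suc s ≡ a + β + β * s
            step = ℕ-Solver.solve-∀

  -- 1/(2 − e^{βx}) = Σ_m (e^{βx} − 1)^m, where only the terms with m ≤ n contribute to x^n
  fubini : EGF
  fubini n = ∑[ m ≤ n ] Cov 0 m n

  fubini-extend : ∀ {n N} → n ≤ N → fubini n ≡ ∑[ m ≤ N ] Cov 0 m n
  fubini-extend n≤N = ∑≤-extend _ n≤N (λ n<m → cong +_ (coverings-vanish 0 n<m))

  fubini-suc : ∀ n → (Cov 0 1 ⊙ fubini) (suc n) ≡ fubini (suc n)
  fubini-suc n = begin
    (Cov 0 1 ⊙ fubini) (suc n)
      ≡⟨ ⊙-cong (suc n) {a′ = Cov 0 1} {b′ = λ i → ∑[ m ≤ suc n ] Cov 0 m i} (λ _ → refl) fubini-extend ⟩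
    (Cov 0 1 ⊙ (λ i → ∑[ m ≤ suc n ] Cov 0 m i)) (suc n)
      ≡⟨ ⊙-sumʳ (suc n) (upTo (2 + n)) (Cov 0 1) (Cov 0) ⟩
    ∑[ m ≤ suc n ] (Cov 0 1 ⊙ Cov 0 m) (suc n)
      ≡⟨ ∑≤-cong (suc n) (λ {m} _ → ⊙-Cov 0 1 m (suc n)) ⟩
    ∑[ m ≤ suc n ] Cov 0 (suc m) (suc n)
      ≡⟨ ∑≤-sucʳ n (λ m → Cov 0 (suc m) (suc n)) ⟩
    ∑[ m ≤ n ] Cov 0 (suc m) (suc n) +ℤ Cov 0 (2 + n) (suc n)
      ≡⟨ cong (∑[ m ≤ n ] Cov 0 (suc m) (suc n) +ℤ_) (cong +_ (coverings-vanish 0 (ℕ.n<1+n (suc n)))) ⟩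
    ∑[ m ≤ n ] Cov 0 (suc m) (suc n) +ℤ + 0
      ≡⟨ ℤ.+-comm (∑[ m ≤ n ] Cov 0 (suc m) (suc n)) (+ 0) ⟩
    Cov 0 0 (suc n) +ℤ ∑[ m ≤ n ] Cov 0 (suc m) (suc n)
      ≡⟨ sym (∑≤-suc n (λ m → Cov 0 m (suc n))) ⟩
    fubini (suc n) ∎

  -- invPrefix solves (2 − e^{βx}) ⊙ g = 1 coefficient by coefficient, and fubini-suc is the same
  -- recursion in the form fubini = 1 + (e^{βx} − 1) ⊙ fubini.
  invPrefix-fubini : ∀ m → invPrefix (twoMinusExp β) m ≡ map (λ i → fubini (m ∸ i)) (upTo (suc m))
  invPrefix-fubini zero    = refl
  invPrefix-fubini (suc m) = cong₂ _∷_ head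
    (trans (invPrefix-fubini m) (trans (List.map-upTo _ (suc m)) (sym (List.map-applyUpTo suc _ (suc m)))))
    where
    φ : ℕ → ℤ → ℤ
    φ i g = + (suc m C suc i) *ℤ twoMinusExp β (suc i) *ℤ g
    term : ℕ → ℤ
    term i = + (suc m C suc i) *ℤ Cov 0 1 (suc i) *ℤ fubini (m ∸ i)
    negate : ∀ c p g → c *ℤ (- p) *ℤ g ≡ - (c *ℤ p *ℤ g)
    negate = solve-∀
    head : - sumℤ (zipWith φ (upTo (suc m)) (invPrefix (twoMinusExp β) m)) ≡ fubini (suc m)
    head = begin
      - sumℤ (zipWith φ (upTo (suc m)) (invPrefix (twoMinusExp β) m))
        ≡⟨ cong (λ gs → - sumℤ (zipWith φ (upTo (suc m)) gs)) (invPrefix-fubini m) ⟩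
      - sumℤ (zipWith φ (upTo (suc m)) (map (λ i → fubini (m ∸ i)) (upTo (suc m))))
        ≡⟨ cong (λ ts → - sumℤ ts) (zipWith-map-self φ (λ i → fubini (m ∸ i)) (upTo (suc m))) ⟩
      - (∑[ i ≤ m ] φ i (fubini (m ∸ i)))
        ≡⟨ cong -_ (∑≤-cong m {g = λ i → - term i} λ {i} _ →
             trans (cong (λ p → + (suc m C suc i) *ℤ - + p *ℤ fubini (m ∸ i)) (sym (coverings-one-group i)))
                   (negate (+ (suc m C suc i)) (Cov 0 1 (suc i)) (fubini (m ∸ i)))) ⟩
      - (∑[ i ≤ m ] (- term i))
        ≡⟨ cong -_ (sumOf-neg (upTo (suc m)) term) ⟩
      - - (∑[ i ≤ m ] term i)
        ≡⟨ ℤ.neg-involutive _ ⟩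
      ∑[ i ≤ m ] term i
        ≡⟨ sym (ℤ.+-identityˡ _) ⟩
      + 0 +ℤ (∑[ i ≤ m ] term i)
        ≡⟨ sym (∑≤-suc m (λ i → + (suc m C i) *ℤ Cov 0 1 i *ℤ fubini (suc m ∸ i))) ⟩
      (Cov 0 1 ⊙ fubini) (suc m)
        ≡⟨ fubini-suc m ⟩
      fubini (suc m) ∎

  inv1-fubini : ∀ m → inv1 (twoMinusExp β) m ≡ fubini m
  inv1-fubini m with invPrefix (twoMinusExp β) m | invPrefix-fubini m
  ... | _ | refl = refl

  powS-fubini : ∀ l {n N} → n ≤ N → powS fubini l n ≡ sumOf (tuples l N) (λ ms → Cov 0 (sum ms) n)
  powS-fubini zero    {zero}  _   = refl
  powS-fubini zero    {suc n} _   = refl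
  powS-fubini (suc l) {n} {N} n≤N = begin
    (fubini ⊙ powS fubini l) n
      ≡⟨ ⊙-cong n {a′ = λ i → ∑[ m ≤ N ] Cov 0 m i} {b′ = P}
                (λ i≤n → fubini-extend (ℕ.≤-trans i≤n n≤N)) (λ i≤n → powS-fubini l (ℕ.≤-trans i≤n n≤N)) ⟩
    ((λ i → ∑[ m ≤ N ] Cov 0 m i) ⊙ P) n
      ≡⟨ ⊙-sumˡ n (upTo (suc N)) (Cov 0) P ⟩
    ∑[ m ≤ N ] (Cov 0 m ⊙ P) n
      ≡⟨ ∑≤-cong N (λ {m} _ → ⊙-sumʳ n (tuples l N) (Cov 0 m) (λ ms → Cov 0 (sum ms))) ⟩
    ∑[ m ≤ N ] sumOf (tuples l N) (λ ms → (Cov 0 m ⊙ Cov 0 (sum ms)) n)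
      ≡⟨ ∑≤-cong N (λ {m} _ → sumOf-cong (tuples l N) (λ {ms} _ → ⊙-Cov 0 m (sum ms) n)) ⟩
    ∑[ m ≤ N ] sumOf (tuples l N) (λ ms → Cov 0 (m + sum ms) n)
      ≡⟨ sym (sumOf-cartesianProductWith _∷_ (upTo (suc N)) (tuples l N) (λ ms → Cov 0 (sum ms) n)) ⟩
    sumOf (tuples (suc l) N) (λ ms → Cov 0 (sum ms) n) ∎
    where
    P : EGF
    P i = sumOf (tuples l N) (λ ms → Cov 0 (sum ms) i)

  H-fubini : ∀ n l c → H n l β c ≡ (expS c ⊙ powS fubini l) n
  H-fubini n l c = ⊙-cong n {a′ = expS c} {b′ = powS fubini l} (λ _ → refl) (λ {i} _ → powS-cong l inv1-fubini i)

  alternating-sum-H : ∀ γ n l k →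
    ∑[ s ≤ k ] ((-[1+ 0 ] ^ℤ (k ∸ s)) *ℤ (+ (k C s)) *ℤ H n l β (γ + β * s))
      ≡ sumOf (tuples l n) (λ ms → Cov γ (k + sum ms) n)
  alternating-sum-H γ n l k = begin
    ∑[ s ≤ k ] (c s *ℤ H n l β (γ + β * s))
      ≡⟨ ∑≤-cong k (λ {s} _ → trans (cong (c s *ℤ_) (H-fubini n l (γ + β * s)))
                                     (sym (⊙-*ˡ n (c s) (expS (γ + β * s)) P))) ⟩
    ∑[ s ≤ k ] ((λ i → c s *ℤ expS (γ + β * s) i) ⊙ P) n
      ≡⟨ sym (⊙-sumˡ n (upTo (suc k)) (λ s i → c s *ℤ expS (γ + β * s) i) P) ⟩
    ((λ i → ∑[ s ≤ k ] (c s *ℤ expS (γ + β * s) i)) ⊙ P) n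
      ≡⟨ ⊙-cong n {a′ = Cov γ k} {b′ = λ i → sumOf (tuples l n) (λ ms → Cov 0 (sum ms) i)}
                (λ {i} _ → inclusion-exclusion k γ i) (λ i≤n → powS-fubini l i≤n) ⟩
    (Cov γ k ⊙ (λ i → sumOf (tuples l n) (λ ms → Cov 0 (sum ms) i))) n
      ≡⟨ ⊙-sumʳ n (tuples l n) (Cov γ k) (λ ms → Cov 0 (sum ms)) ⟩
    sumOf (tuples l n) (λ ms → (Cov γ k ⊙ Cov 0 (sum ms)) n)
      ≡⟨ sumOf-cong (tuples l n) (λ {ms} _ → ⊙-Cov γ k (sum ms) n) ⟩
    sumOf (tuples l n) (λ ms → Cov γ (k + sum ms) n) ∎
    where
    c : ℕ → ℤ
    c s = (-[1+ 0 ] ^ℤ (k ∸ s)) *ℤ + (k C s)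
    P : EGF
    P = powS fubini l

module Counting (γ β l : ℕ) where

  open Coverings β using (coverings; coverings-vanish; Cov)

  data Group : Set where
    part  : ℕ → Group
    block : Fin l → ℕ → Group

  _≟ᴳ_ : DecidableEquality Group
  part p    ≟ᴳ part q    = map′ (cong part) (λ { refl → refl }) (p ℕ.≟ q)
  part _    ≟ᴳ block _ _ = no (λ ())
  block _ _ ≟ᴳ part _    = no (λ ())
  block i b ≟ᴳ block j c = map′ (λ { (refl , refl) → refl }) (λ { refl → refl , refl }) (i Fin.≟ j ×-dec b ℕ.≟ c)

  Slot : Set
  Slot = Place γ β l

  group : Slot → Maybe Group
  group (first (inj₁ _))       = nothing
  group (first (inj₂ (p , _))) = just (part p)
  group (later i b _)          = just (block i b)

  place : Group → Fin β → Slot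
  place (part p)    c = first (inj₂ (p , c))
  place (block i b) c = later i b c

  group-place : ∀ g c → group (place g c) ≡ just g
  group-place (part p)    c = refl
  group-place (block i b) c = refl

  place-injective : ∀ {g g′ c c′} → place g c ≡ place g′ c′ → g ≡ g′ × c ≡ c′
  place-injective {part p}    {part _}    refl = refl , refl
  place-injective {block i b} {block _ _} refl = refl , refl

  plain : Fin γ → Slot
  plain c = first (inj₁ c)

  plain≢place : ∀ g {c c′} → plain c ≢ place g c′
  plain≢place (part _)    ()
  plain≢place (block _ _) ()

  Occupies : ∀ {n} → Vec Slot n → Group → Set
  Occupies v g = ∃[ x ] group (lookup v x) ≡ just g

  occupies? : ∀ {n} (v : Vec Slot n) g → Dec (Occupies v g)
  occupies? v g = any? (λ x → ≡-decMaybe _≟ᴳ_ (group (lookup v x)) (just g))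

  OccupiesExactly : ∀ {n} → Vec Slot n → List Group → Set
  OccupiesExactly v R = ∀ g → g ∈ R ⇔ Occupies v g

  _∖_ : List Group → Group → List Group
  R ∖ g = filter (λ g′ → ¬? (g′ ≟ᴳ g)) R

  ∈-∖⁺ : ∀ {g g′ R} → g′ ∈ R → g′ ≢ g → g′ ∈ R ∖ g
  ∈-∖⁺ {g} = ∈-filter⁺ (λ g′ → ¬? (g′ ≟ᴳ g))

  ∈-∖⁻ : ∀ {g g′} R → g′ ∈ R ∖ g → g′ ∈ R × g′ ≢ g
  ∈-∖⁻ {g} R = ∈-filter⁻ (λ g′ → ¬? (g′ ≟ᴳ g)) {xs = R}

  unique-∖ : ∀ {g R} → Unique R → Unique (R ∖ g)
  unique-∖ {g} = filter⁺ (λ g′ → ¬? (g′ ≟ᴳ g))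

  length-∖ : ∀ {g R} → Unique R → g ∈ R → suc (length (R ∖ g)) ≡ length R
  length-∖ {g} {x ∷ R} (x∉R ∷ _) (here refl) = cong (suc ∘ length)
    (trans (List.filter-reject (λ g′ → ¬? (g′ ≟ᴳ g)) (λ x≢x → x≢x refl))
           (List.filter-all (λ g′ → ¬? (g′ ≟ᴳ g)) (All.map (λ x≢y y≡x → x≢y (sym y≡x)) x∉R)))
  length-∖ {g} {x ∷ R} (x∉R ∷ !R) (there g∈R) = cong suc (trans
    (cong length (List.filter-accept (λ g′ → ¬? (g′ ≟ᴳ g)) (All.lookup x∉R g∈R)))
    (length-∖ !R g∈R))

  heads : List Group → List Slot
  heads R = map plain (allFin γ) ++ concatMap (λ g → map (place g) (allFin β)) R

  ∈-heads-place : ∀ {R g} c → g ∈ R → place g c ∈ heads R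
  ∈-heads-place {R} {g} c g∈R = ∈-++⁺ʳ (map plain (allFin γ))
    (∈-concatMap⁺ (λ g → map (place g) (allFin β)) (lose g∈R (∈-map⁺ (place g) (∈-allFin c))))

  ∈-heads⁺ : ∀ {R} h → (∀ {g} → group h ≡ just g → g ∈ R) → h ∈ heads R
  ∈-heads⁺ (first (inj₁ c))       allowed = ∈-++⁺ˡ (∈-map⁺ plain (∈-allFin c))
  ∈-heads⁺ (first (inj₂ (p , c))) allowed = ∈-heads-place c (allowed refl)
  ∈-heads⁺ (later i b c)          allowed = ∈-heads-place c (allowed refl)

  ∈-heads⁻ : ∀ {R h g} → h ∈ heads R → group h ≡ just g → g ∈ R
  ∈-heads⁻ {R} h∈ h∈g with ∈-++⁻ (map plain (allFin γ)) h∈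
  ... | inj₁ h∈plain with ∈-map⁻ plain h∈plain
  ...   | _ , _ , refl with () ← h∈g
  ∈-heads⁻ {R} h∈ h∈g | inj₂ h∈placed with find (∈-concatMap⁻ (λ g → map (place g) (allFin β)) h∈placed)
  ... | g , g∈R , h∈g′ with ∈-map⁻ (place g) h∈g′
  ...   | c , _ , refl = subst (_∈ R) (just-injective (trans (sym (group-place g c)) h∈g)) g∈R

  unique-heads : ∀ {R} → Unique R → Unique (heads R)
  unique-heads {R} !R = ++⁺ (map⁺ (λ { refl → refl }) (allFin⁺ γ))
    (unique-concatMap (λ g → map (place g) (allFin β)) !R (λ _ → map⁺ (proj₂ ∘ place-injective) (allFin⁺ β)) separated)
    plain∉placed
    where
    separated : ∀ {g g′ h} → h ∈ map (place g) (allFin β) → h ∈ map (place g′) (allFin β) → g ≡ g′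
    separated h∈g h∈g′ with ∈-map⁻ (place _) h∈g | ∈-map⁻ (place _) h∈g′
    ... | _ , _ , refl | _ , _ , eq = proj₁ (place-injective eq)
    plain∉placed : ∀ {h} → ¬ (h ∈ map plain (allFin γ) × h ∈ concatMap (λ g → map (place g) (allFin β)) R)
    plain∉placed (h∈plain , h∈placed)
      with ∈-map⁻ plain h∈plain | find (∈-concatMap⁻ (λ g → map (place g) (allFin β)) {xs = R} h∈placed)
    ... | _ , _ , refl | g , _ , h∈g with ∈-map⁻ (place g) h∈g
    ...   | _ , _ , eq = plain≢place g eq

  mutual
    placements : List Group → (n : ℕ) → List (Vec Slot n)
    placements R (suc n) = concatMap (λ h → map (h ∷_) (continuations R n (group h))) (heads R)
    placements []      zero = [ [] ]
    placements (_ ∷ _) zero = []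

    -- After a first element in group g, the others either still occupy g or occupy exactly R ∖ g.
    continuations : List Group → (n : ℕ) → Maybe Group → List (Vec Slot n)
    continuations R n nothing  = placements R n
    continuations R n (just g) = placements R n ++ placements (R ∖ g) n

  module _ {n : ℕ} {R : List Group} {h : Slot} {w : Vec Slot n} where

    exactly-∷ : (∀ {g} → group h ≡ just g → g ∈ R) → OccupiesExactly w R → OccupiesExactly (h ∷ w) R
    exactly-∷ allowed w≈R g = mk⇔
      (λ g∈R → let x , e = to (w≈R g) g∈R in Fin.suc x , e)
      (λ { (Fin.zero , e) → allowed e ; (Fin.suc x , e) → from (w≈R g) (x , e) })

    exactly-∷-∖ : ∀ {g} → group h ≡ just g → g ∈ R → OccupiesExactly w (R ∖ g) → OccupiesExactly (h ∷ w) R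
    exactly-∷-∖ {g} h∈g g∈R w≈R∖g g′ = mk⇔ occupied member
      where
      occupied : g′ ∈ R → Occupies (h ∷ w) g′
      occupied g′∈R with g′ ≟ᴳ g
      ... | yes refl  = Fin.zero , h∈g
      ... | no  g′≢g = let x , e = to (w≈R∖g g′) (∈-∖⁺ g′∈R g′≢g) in Fin.suc x , e
      member : Occupies (h ∷ w) g′ → g′ ∈ R
      member (Fin.zero  , e) = subst (_∈ R) (just-injective (trans (sym h∈g) e)) g∈R
      member (Fin.suc x , e) = proj₁ (∈-∖⁻ R (from (w≈R∖g g′) (x , e)))

    exactly-tail : (∀ {g} → group h ≡ just g → Occupies w g) → OccupiesExactly (h ∷ w) R → OccupiesExactly w R
    exactly-tail repeated hw≈R g = mk⇔ occupied (λ (x , e) → from (hw≈R g) (Fin.suc x , e))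
      where
      occupied : g ∈ R → Occupies w g
      occupied g∈R with to (hw≈R g) g∈R
      ... | Fin.zero  , e = repeated e
      ... | Fin.suc x , e = x , e

    exactly-tail-∖ : ∀ {g} → group h ≡ just g → ¬ Occupies w g → OccupiesExactly (h ∷ w) R →
                     OccupiesExactly w (R ∖ g)
    exactly-tail-∖ {g} h∈g w∌g hw≈R g′ = mk⇔ occupied member
      where
      occupied : g′ ∈ R ∖ g → Occupies w g′
      occupied g′∈R∖g with ∈-∖⁻ R g′∈R∖g
      ... | g′∈R , g′≢g with to (hw≈R g′) g′∈R
      ...   | Fin.zero  , e = ⊥-elim (g′≢g (just-injective (trans (sym e) h∈g)))
      ...   | Fin.suc x , e = x , e
      member : Occupies w g′ → g′ ∈ R ∖ g
      member (x , e) = ∈-∖⁺ (from (hw≈R g′) (Fin.suc x , e)) (λ { refl → w∌g (x , e) })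

  placements-sound : ∀ R n {v} → v ∈ placements R n → OccupiesExactly v R
  placements-sound R       (suc n) {h ∷ w} hw∈ with ∈-concatMap-∷⁻ (λ h → continuations R n (group h)) (heads R) hw∈
  ... | h∈heads , w∈ with group h in h∈g
  ...   | nothing = exactly-∷ (∈-heads⁻ h∈heads) (placements-sound R n w∈)
  ...   | just g with ∈-++⁻ (placements R n) w∈
  ...     | inj₁ w∈R   = exactly-∷ (∈-heads⁻ h∈heads) (placements-sound R n w∈R)
  ...     | inj₂ w∈R∖g = exactly-∷-∖ h∈g (∈-heads⁻ h∈heads h∈g) (placements-sound (R ∖ g) n w∈R∖g)
  placements-sound []      zero    (here refl) g = mk⇔ (λ ()) (λ { (() , _) })

  placements-complete : ∀ R n (v : Vec Slot n) → OccupiesExactly v R → v ∈ placements R n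
  placements-complete R       (suc n) (h ∷ w) hw≈R =
    ∈-concatMap-∷⁺ (λ h → continuations R n (group h)) (∈-heads⁺ h (λ {g} e → from (hw≈R g) (Fin.zero , e))) tail∈
    where
    tail∈ : w ∈ continuations R n (group h)
    tail∈ with group h in h∈g
    ... | nothing = placements-complete R n w (exactly-tail (λ e → contradiction (trans (sym h∈g) e) λ ()) hw≈R)
    ... | just g with occupies? w g
    ...   | yes w∋g = ∈-++⁺ˡ (placements-complete R n w (exactly-tail repeated hw≈R))
      where repeated : ∀ {g′} → group h ≡ just g′ → Occupies w g′
            repeated e = subst (Occupies w) (just-injective (trans (sym h∈g) e)) w∋g
    ...   | no  w∌g = ∈-++⁺ʳ (placements R n) (placements-complete (R ∖ g) n w (exactly-tail-∖ h∈g w∌g hw≈R))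
  placements-complete []      zero [] _   = here refl
  placements-complete (g ∷ _) zero [] []≈R with () ← proj₁ (to ([]≈R g) (here refl))

  unique-placements : ∀ {R} → Unique R → ∀ n → Unique (placements R n)
  unique-placements {R} !R (suc n) =
    unique-concatMap (λ h → map (h ∷_) (continuations R n (group h))) (unique-heads !R)
                     (λ h∈ → map⁺ Vec.∷-injectiveʳ (unique-continuations h∈)) separated
    where
    separated : ∀ {h h′ v} → v ∈ map (h ∷_) (continuations R n (group h)) →
                v ∈ map (h′ ∷_) (continuations R n (group h′)) → h ≡ h′
    separated v∈ v∈′ with ∈-map⁻ (_ ∷_) v∈ | ∈-map⁻ (_ ∷_) v∈′
    ... | _ , _ , refl | _ , _ , eq = Vec.∷-injectiveˡ eq
    unique-continuations : ∀ {h} → h ∈ heads R → Unique (continuations R n (group h))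
    unique-continuations {h} h∈ with group h in h∈g
    ... | nothing = unique-placements !R n
    ... | just g  = ++⁺ (unique-placements !R n) (unique-placements (unique-∖ !R) n) disjoint
      where
      disjoint : ∀ {w} → ¬ (w ∈ placements R n × w ∈ placements (R ∖ g) n)
      disjoint (w∈R , w∈R∖g) = proj₂ (∈-∖⁻ R (from (placements-sound (R ∖ g) n w∈R∖g g)
                                                   (to (placements-sound R n w∈R g) (∈-heads⁻ h∈ h∈g)))) refl
  unique-placements {[]}    _ zero = All.[] ∷ []
  unique-placements {_ ∷ _} _ zero = []

  length-concatMap-heads : ∀ {B : Set} R (f : Slot → List B) {x y} →
    (∀ c → length (f (plain c)) ≡ x) → (∀ {g} c → g ∈ R → length (f (place g c)) ≡ y) →
    length (concatMap f (heads R)) ≡ γ * x + length R * β * y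
  length-concatMap-heads R f {x} {y} plain-length place-length = begin
    length (concatMap f (plains ++ placed))
      ≡⟨ cong length (List.concatMap-++ f plains placed) ⟩
    length (concatMap f plains ++ concatMap f placed)
      ≡⟨ List.length-++ (concatMap f plains) ⟩
    length (concatMap f plains) + length (concatMap f placed)
      ≡⟨ cong₂ _+_ (length-concatMap-const f plains plain-count) (length-concatMap-const f placed placed-count) ⟩
    length plains * x + length placed * y
      ≡⟨ cong₂ (λ a b → a * x + b * y) (length-map-allFin plain)
               (length-concatMap-const (λ g → map (place g) (allFin β)) R (λ _ → length-map-allFin (place _))) ⟩
    γ * x + length R * β * y ∎
    where
    plains = map plain (allFin γ)
    placed = concatMap (λ g → map (place g) (allFin β)) R
    plain-count : ∀ {h} → h ∈ plains → length (f h) ≡ x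
    plain-count h∈ with ∈-map⁻ plain h∈
    ... | c , _ , refl = plain-length c
    placed-count : ∀ {h} → h ∈ placed → length (f h) ≡ y
    placed-count h∈ with find (∈-concatMap⁻ (λ g → map (place g) (allFin β)) {xs = R} h∈)
    ... | g , g∈R , h∈g with ∈-map⁻ (place g) h∈g
    ...   | c , _ , refl = place-length c g∈R

  length-placements : ∀ {R} → Unique R → ∀ n → length (placements R n) ≡ coverings γ (length R) n
  length-placements {R} !R (suc n) =
    trans (length-concatMap-heads R (λ h → map (h ∷_) (continuations R n (group h))) plain-length place-length)
          (regroup γ (length R) β X Y)
    where
    X = coverings γ (length R) n
    Y = coverings γ (pred (length R)) n
    regroup : ∀ γ j β x y → γ * x + j * β * (x + y) ≡ (γ + j * β) * x + j * β * y
    regroup = ℕ-Solver.solve-∀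
    plain-length : ∀ c → length (map (plain c ∷_) (placements R n)) ≡ X
    plain-length c = trans (List.length-map _ (placements R n)) (length-placements !R n)
    place-length : ∀ {g} c → g ∈ R → length (map (place g c ∷_) (continuations R n (group (place g c)))) ≡ X + Y
    place-length {g} c g∈R rewrite group-place g c = begin
      length (map (place g c ∷_) (placements R n ++ placements (R ∖ g) n))
        ≡⟨ List.length-map _ (placements R n ++ _) ⟩
      length (placements R n ++ placements (R ∖ g) n)
        ≡⟨ List.length-++ (placements R n) ⟩
      length (placements R n) + length (placements (R ∖ g) n)
        ≡⟨ cong₂ _+_ (length-placements !R n) (length-placements (unique-∖ !R) n) ⟩
      X + coverings γ (length (R ∖ g)) n
        ≡⟨ cong (λ m → X + coverings γ m n) (cong pred (length-∖ !R g∈R)) ⟩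
      X + Y ∎
  length-placements {[]}    _ zero = refl
  length-placements {_ ∷ _} _ zero = refl

  groupsOf : ℕ → Vec ℕ l → List Group
  groupsOf k ms = map part (upTo k) ++ concatMap (λ i → map (block i) (upTo (lookup ms i))) (allFin l)

  module _ (k : ℕ) (ms : Vec ℕ l) where

    private
      blocksOf : Fin l → List Group
      blocksOf i = map (block i) (upTo (lookup ms i))

    ∈-groupsOf-part : ∀ {p} → part p ∈ groupsOf k ms ⇔ p < k
    ∈-groupsOf-part = mk⇔ bounded (λ p<k → ∈-++⁺ˡ (∈-map⁺ part (∈-upTo⁺ p<k)))
      where
      bounded : ∀ {p} → part p ∈ groupsOf k ms → p < k
      bounded p∈ with ∈-++⁻ (map part (upTo k)) p∈
      ... | inj₁ p∈parts with ∈-map⁻ part p∈parts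
      ...   | _ , p<k , refl = ∈-upTo⁻ p<k
      bounded p∈ | inj₂ p∈blocks with find (∈-concatMap⁻ blocksOf {xs = allFin l} p∈blocks)
      ... | i , _ , p∈i with ∈-map⁻ (block i) p∈i
      ...   | _ , _ , ()

    ∈-groupsOf-block : ∀ {i b} → block i b ∈ groupsOf k ms ⇔ b < lookup ms i
    ∈-groupsOf-block {i} = mk⇔ bounded
      (λ b< → ∈-++⁺ʳ (map part (upTo k)) (∈-concatMap⁺ blocksOf (lose (∈-allFin i) (∈-map⁺ (block i) (∈-upTo⁺ b<)))))
      where
      bounded : ∀ {i b} → block i b ∈ groupsOf k ms → b < lookup ms i
      bounded b∈ with ∈-++⁻ (map part (upTo k)) b∈
      ... | inj₁ b∈parts with ∈-map⁻ part b∈parts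
      ...   | _ , _ , ()
      bounded b∈ | inj₂ b∈blocks with find (∈-concatMap⁻ blocksOf {xs = allFin l} b∈blocks)
      ... | i , _ , b∈i with ∈-map⁻ (block i) b∈i
      ...   | _ , b< , refl = ∈-upTo⁻ b<

    unique-groupsOf : Unique (groupsOf k ms)
    unique-groupsOf = ++⁺ (map⁺ (λ { refl → refl }) (upTo⁺ k))
      (unique-concatMap blocksOf (allFin⁺ l) (λ _ → map⁺ (λ { refl → refl }) (upTo⁺ _)) separated)
      parts∉blocks
      where
      separated : ∀ {i j g} → g ∈ blocksOf i → g ∈ blocksOf j → i ≡ j
      separated g∈i g∈j with ∈-map⁻ (block _) g∈i | ∈-map⁻ (block _) g∈j
      ... | _ , _ , refl | _ , _ , refl = refl
      parts∉blocks : ∀ {g} → ¬ (g ∈ map part (upTo k) × g ∈ concatMap blocksOf (allFin l))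
      parts∉blocks (g∈parts , g∈blocks) with ∈-map⁻ part g∈parts | find (∈-concatMap⁻ blocksOf {xs = allFin l} g∈blocks)
      ... | _ , _ , refl | i , _ , g∈i with ∈-map⁻ (block i) g∈i
      ...   | _ , _ , ()

    length-groupsOf : length (groupsOf k ms) ≡ k + sum ms
    length-groupsOf = begin
      length (map part (upTo k) ++ concatMap blocksOf (allFin l))
        ≡⟨ List.length-++ (map part (upTo k)) ⟩
      length (map part (upTo k)) + length (concatMap blocksOf (allFin l))
        ≡⟨ cong₂ _+_ (trans (List.length-map part (upTo k)) (List.length-upTo k)) (length-concatMap-allFin blocksOf) ⟩
      k + sum (tabulate (length ∘ blocksOf))
        ≡⟨ cong (λ xs → k + sum xs)
                (trans (Vec.tabulate-cong (λ i → trans (List.length-map (block i) (upTo (lookup ms i))) (List.length-upTo _)))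
                       (Vec.tabulate∘lookup ms)) ⟩
      k + sum ms ∎

  group-just : ∀ e {g} → group e ≡ just g → ∃[ c ] e ≡ place g c
  group-just (first (inj₂ (p , c))) refl = c , refl
  group-just (later i b c)          refl = c , refl

  height : Fin l → Maybe Group → ℕ
  height i (just (block i′ b)) with i′ Fin.≟ i
  ... | yes _ = suc b
  ... | no  _ = 0
  height i (just (part _)) = 0
  height i nothing         = 0

  height-block : ∀ i b → height i (just (block i b)) ≡ suc b
  height-block i b with i Fin.≟ i
  ... | yes _   = refl
  ... | no  i≢i = ⊥-elim (i≢i refl)

  height-inv : ∀ i mg {b} → b < height i mg → ∃[ b₀ ] b ≤ b₀ × mg ≡ just (block i b₀)
  height-inv i (just (block i′ b₀)) b< with i′ Fin.≟ i
  ... | yes refl = b₀ , ℕ.≤-pred b< , refl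
  height-inv i (just (block i′ b₀)) () | no _
  height-inv i (just (part _)) ()
  height-inv i nothing ()

  -- The blocks of a later section are numbered 0, …, m − 1, so m is 1 + the largest number used.
  blockCount : ∀ {n} → Fin l → Vec Slot n → ℕ
  blockCount i []      = 0
  blockCount i (e ∷ v) = height i (group e) ⊔ blockCount i v

  blockCounts : ∀ {n} → Vec Slot n → Vec ℕ l
  blockCounts v = tabulate (λ i → blockCount i v)

  <-blockCount : ∀ {n i b} (v : Vec Slot n) → Occupies v (block i b) → b < blockCount i v
  <-blockCount {i = i} {b} (e ∷ v) (Fin.zero , e∈) =
    ℕ.≤-trans (ℕ.≤-reflexive (sym (trans (cong (height i) e∈) (height-block i b)))) (ℕ.m≤m⊔n _ (blockCount i v))
  <-blockCount {i = i} (e ∷ v) (Fin.suc x , e∈) =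
    ℕ.≤-trans (<-blockCount v (x , e∈)) (ℕ.m≤n⊔m (height i (group e)) _)

  blockCount-attained : ∀ {n i b} (v : Vec Slot n) → b < blockCount i v → ∃[ b₀ ] b ≤ b₀ × Occupies v (block i b₀)
  blockCount-attained {i = i} {b} (e ∷ v) b< with ℕ.⊔-sel (height i (group e)) (blockCount i v)
  ... | inj₁ eq = let b₀ , b≤b₀ , e∈ = height-inv i (group e) (subst (b <_) eq b<) in b₀ , b≤b₀ , Fin.zero , e∈
  ... | inj₂ eq = let b₀ , b≤b₀ , x , e∈ = blockCount-attained v (subst (b <_) eq b<) in b₀ , b≤b₀ , Fin.suc x , e∈

  exactly⇒blockCounts : ∀ {n k ms} (v : Vec Slot n) → OccupiesExactly v (groupsOf k ms) → ms ≡ blockCounts v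
  exactly⇒blockCounts {k = k} {ms} v v≈ = trans (sym (Vec.tabulate∘lookup ms)) (Vec.tabulate-cong λ i →
    ℕ.≤-antisym (≤-from-< (λ b< → <-blockCount v (to (v≈ (block i _)) (from (∈-groupsOf-block k ms) b<))))
                (≤-from-< (λ b< → let b₀ , b≤b₀ , occ = blockCount-attained v b< in
                                  ℕ.≤-<-trans b≤b₀ (to (∈-groupsOf-block k ms) (from (v≈ (block i b₀)) occ)))))

  exactly⇒valid : ∀ {n k ms} (v : Vec Slot n) → k ≤ n → OccupiesExactly v (groupsOf k ms) →
                  ValidArrangement n γ β l (k , v)
  exactly⇒valid {k = k} {ms} v k≤n v≈ = k≤n , labelled , nonempty , downward
    where
    labelled : ∀ x p c → lookup v x ≡ first (inj₂ (p , c)) → p < k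
    labelled x p c e = to (∈-groupsOf-part k ms) (from (v≈ (part p)) (x , cong group e))
    nonempty : ∀ p → p < k → ∃[ x ] ∃[ c ] lookup v x ≡ first (inj₂ (p , c))
    nonempty p p<k = let x , e = to (v≈ (part p)) (from (∈-groupsOf-part k ms) p<k) in x , group-just (lookup v x) e
    downward : ∀ x i b c → lookup v x ≡ later i b c →
               ∀ b′ → b′ < b → ∃[ y ] ∃[ c′ ] lookup v y ≡ later i b′ c′
    downward x i b c e b′ b′<b =
      let b<ms = to (∈-groupsOf-block k ms) (from (v≈ (block i b)) (x , cong group e))
          y , e′ = to (v≈ (block i b′)) (from (∈-groupsOf-block k ms) (ℕ.<-trans b′<b b<ms))
      in y , group-just (lookup v y) e′

  valid⇒exactly : ∀ {n k} (v : Vec Slot n) → ValidArrangement n γ β l (k , v) → OccupiesExactly v (groupsOf k (blockCounts v))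
  valid⇒exactly {k = k} v (_ , labelled , nonempty , _) (part p) = mk⇔
    (λ p∈ → let x , _ , e = nonempty p (to (∈-groupsOf-part k (blockCounts v)) p∈) in x , cong group e)
    (λ (x , e) → let c , e′ = group-just (lookup v x) e in from (∈-groupsOf-part k (blockCounts v)) (labelled x p c e′))
  valid⇒exactly {k = k} v (_ , _ , _ , downward) (block i b) = mk⇔ occupied member
    where
    count = Vec.lookup∘tabulate (λ i → blockCount i v) i
    member : Occupies v (block i b) → block i b ∈ groupsOf k (blockCounts v)
    member occ = from (∈-groupsOf-block k (blockCounts v)) (subst (b <_) (sym count) (<-blockCount v occ))
    occupied : block i b ∈ groupsOf k (blockCounts v) → Occupies v (block i b)
    occupied b∈ with blockCount-attained v (subst (b <_) count (to (∈-groupsOf-block k (blockCounts v)) b∈))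
    ... | b₀ , b≤b₀ , x , e with ℕ.m≤n⇒m<n∨m≡n b≤b₀
    ...   | inj₂ refl = x , e
    ...   | inj₁ b<b₀ = let c , e′ = group-just (lookup v x) e
                            y , _ , e″ = downward x i b₀ c e′ b b<b₀
                        in y , cong group e″

  ∈-placements⇒length≤ : ∀ {R n} {v : Vec Slot n} → Unique R → v ∈ placements R n → length R ≤ n
  ∈-placements⇒length≤ {R} {n} !R v∈ = ℕ.≮⇒≥ λ n<|R| → ℕ.<⇒≢ (∈-length v∈)
    (sym (trans (length-placements !R n) (coverings-vanish γ n<|R|)))

  shapes : ℕ → List (ℕ × Vec ℕ l)
  shapes n = cartesianProduct (upTo (suc n)) (tuples l n)

  arrangementsOfShape : ∀ n → ℕ × Vec ℕ l → List (Arrangement n γ β l)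
  arrangementsOfShape n (k , ms) = map (k ,_) (placements (groupsOf k ms) n)

  arrangements : (n : ℕ) → List (Arrangement n γ β l)
  arrangements n = concatMap (arrangementsOfShape n) (shapes n)

  ∈-arrangements : ∀ n a → a ∈ arrangements n ⇔ ValidArrangement n γ β l a
  ∈-arrangements n (k , v) = mk⇔ valid member
    where
    valid : (k , v) ∈ arrangements n → ValidArrangement n γ β l (k , v)
    valid a∈ with find (∈-concatMap⁻ (arrangementsOfShape n) {xs = shapes n} a∈)
    ... | (k , ms) , kms∈ , a∈k with ∈-map⁻ (k ,_) a∈k
    ...   | v , v∈ , refl = exactly⇒valid {ms = ms} v (ℕ.≤-pred (∈-upTo⁻ k∈)) (placements-sound (groupsOf k ms) n v∈)
      where k∈ = proj₁ (∈-cartesianProduct⁻ (upTo (suc n)) (tuples l n) kms∈)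
    member : ValidArrangement n γ β l (k , v) → (k , v) ∈ arrangements n
    member valid@(k≤n , _) = ∈-concatMap⁺ (arrangementsOfShape n)
      (lose (∈-cartesianProduct⁺ (∈-upTo⁺ (s≤s k≤n)) (∈-tuples⁺ ms bounded)) (∈-map⁺ (k ,_) v∈))
      where
      ms = blockCounts v
      v∈ : v ∈ placements (groupsOf k ms) n
      v∈ = placements-complete (groupsOf k ms) n v (valid⇒exactly v valid)
      bounded : ∀ i → lookup ms i ≤ n
      bounded i = ℕ.≤-trans (lookup≤sum ms i) (ℕ.≤-trans (ℕ.m≤n+m (sum ms) k)
        (subst (_≤ n) (length-groupsOf k ms) (∈-placements⇒length≤ (unique-groupsOf k ms) v∈)))

  unique-arrangements : ∀ n → Unique (arrangements n)
  unique-arrangements n = unique-concatMap (arrangementsOfShape n)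
    (cartesianProduct⁺ (upTo⁺ (suc n)) (unique-tuples l n))
    (λ {(k , ms)} _ → map⁺ (cong proj₂) (unique-placements (unique-groupsOf k ms) n))
    separated
    where
    separated : ∀ {kms kms′ a} → a ∈ arrangementsOfShape n kms → a ∈ arrangementsOfShape n kms′ → kms ≡ kms′
    separated {k , ms} {k′ , ms′} a∈ a∈′ with ∈-map⁻ (k ,_) a∈ | ∈-map⁻ (k′ ,_) a∈′
    ... | v , v∈ , refl | _ , v∈′ , refl = cong (k ,_) (trans
      (exactly⇒blockCounts v (placements-sound (groupsOf k ms) n v∈))
      (sym (exactly⇒blockCounts v (placements-sound (groupsOf k ms′) n v∈′))))

  length-arrangements : ∀ n →
    + length (arrangements n) ≡ ∑[ k ≤ n ] sumOf (tuples l n) (λ ms → Cov γ (k + sum ms) n)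
  length-arrangements n = begin
    + length (arrangements n)
      ≡⟨ lengthℤ-concatMap (arrangementsOfShape n) (shapes n) ⟩
    sumOf (shapes n) (λ kms → + length (arrangementsOfShape n kms))
      ≡⟨ sumOf-cartesianProductWith _,_ (upTo (suc n)) (tuples l n) _ ⟩
    ∑[ k ≤ n ] sumOf (tuples l n) (λ ms → + length (arrangementsOfShape n (k , ms)))
      ≡⟨ ∑≤-cong n (λ {k} _ → sumOf-cong (tuples l n) (λ {ms} _ → cong +_ (begin
           length (map (k ,_) (placements (groupsOf k ms) n)) ≡⟨ List.length-map (k ,_) (placements (groupsOf k ms) n) ⟩
           length (placements (groupsOf k ms) n)              ≡⟨ length-placements (unique-groupsOf k ms) n ⟩
           coverings γ (length (groupsOf k ms)) n             ≡⟨ cong (λ m → coverings γ m n) (length-groupsOf k ms) ⟩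
           coverings γ (k + sum ms) n                         ∎))) ⟩
    ∑[ k ≤ n ] sumOf (tuples l n) (λ ms → Cov γ (k + sum ms) n) ∎

theorem13 : (γ n β λ′ : ℕ) → 1 ≤ β → 1 ≤ λ′ →
    Σ ℕ λ N →
      HasCardinality (ValidArrangement n γ β (λ′ ∸ 1)) N
      × (+ N ≡ ∑[ k ≤ n ] ∑[ s ≤ k ]
           ((-[1+ 0 ] ^ℤ (k ∸ s)) *ℤ (+ (k C s)) *ℤ H n (λ′ ∸ 1) β (γ + β * s)))
theorem13 γ n β λ′ _ _ =
  length (arrangements n) , (arrangements n , unique-arrangements n , ∈-arrangements n , refl) ,
  trans (length-arrangements n) (sym (∑≤-cong n (λ {k} _ → alternating-sum-H γ n l k)))
  where
  l = λ′ ∸ 1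
  open Coverings β using (alternating-sum-H)
  open Counting γ β l using (arrangements; unique-arrangements; ∈-arrangements; length-arrangements)
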